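{- A positive integer $x>1$ is a $\tau_3$-atom if and only if either $x$ is a prime, or $x=3p_1p_2\cdots p_m$ with $m\ge 1$, where each $p_i$ is a (positive) prime with $p_i\neq 3$.
   Context: For a positive integer $n$ and integers $x,y$, write $x\,\tau_n\,y$ if $x\equiv y \pmod n$. For a nonzero nonunit integer $x$, a $\tau_n$-factorization of $x$ is an expression $x=\lambda a_1a_2\cdots a_k$ with $\lambda\in\{1,-1\}$, each $a_i$ a nonzero nonunit integer (i.e. $a_i\neq 0,\pm1$), and $a_i\equiv a_j \pmod n$ for all $i,j$; it is proper if $k>1$. A nonzero nonunit integer $x$ is a $\tau_n$-atom if it has no proper $\tau_n$-factorization. "Prime" means a positive prime number. -}

module Defs where

open import Data.Nat using (ℕ; _<_)
open import Data.Integer using (ℤ; +_; -_; _-_; _*_; 1ℤ; -1ℤ; 0ℤ)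
open import Data.Integer.Divisibility using (_∣_)
open import Data.List using (List; length; foldr)
open import Data.List.Relation.Unary.All using (All)
open import Data.Product using (Σ; _×_; ∃)
open import Data.Sum using (_⊎_)
open import Relation.Nullary using (¬_)
open import Relation.Binary.PropositionalEquality using (_≡_; _≢_)

prodℤ : List ℤ → ℤ
prodℤ = foldr _*_ 1ℤ

_τ[_]_ : ℤ → ℕ → ℤ → Set
x τ[ n ] y = (+ n) ∣ (x - y)

NonzeroNonunit : ℤ → Set
NonzeroNonunit a = (a ≢ 0ℤ) × (a ≢ 1ℤ) × (a ≢ -1ℤ)

IsSign : ℤ → Set
IsSign s = (s ≡ 1ℤ) ⊎ (s ≡ -1ℤ)

PairwiseTau : ℕ → List ℤ → Set
PairwiseTau n as = All (λ a → All (λ b → a τ[ n ] b) as) as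

-- a τ_n-factorization of x: x = s * a_1 * ... * a_k, s ∈ {1,-1},
-- each a_i nonzero nonunit, a_i ≡ a_j (mod n) for all i, j.
-- (The list is nonempty automatically in use, since x is a nonunit.)
record TauFactorization (n : ℕ) (x : ℤ) : Set where
  field
    sign    : ℤ
    factors : List ℤ
    isSign  : IsSign sign
    nonunit : All NonzeroNonunit factors
    congr   : PairwiseTau n factors
    eq      : x ≡ sign * prodℤ factors

Proper : ∀ {n x} → TauFactorization n x → Set
Proper f = 1 < length (TauFactorization.factors f)

IsTauAtom : ℕ → ℤ → Set
IsTauAtom n x = NonzeroNonunit x × ¬ (Σ (TauFactorization n x) Proper)

module Submission where

-- A τₙ-factorization x = ±a₁⋯aₖ gives |x| = |a₁|⋯|aₖ| with every |aᵢ| ≥ 2.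
-- Atoms.  (i) A prime admits no splitting |x| = a·m with a, m ≥ 2, so it has
-- no proper factorization, for any modulus.  (ii) If a prime p divides |x|, it
-- divides some factor and hence, by congruence mod p, every factor; a proper
-- τₚ-factorization thus forces p² ∣ |x|.  So p·y with p ∤ y is a τₚ-atom, and
-- 3·p₁⋯pₘ with pᵢ ≠ 3 is one.
-- Non-atoms.  Let x be composite.  If 3 ∤ x, write x = q·d with q, d ≥ 2; as
-- ±1 are the only units mod 3, q ≡ d or q ≡ -d (mod 3), so x = q·d or
-- x = (-1)·q·(-d) is a proper τ₃-factorization.  If 9 ∣ x, then x = 3·y with
-- 3 ∣ y is one.  Otherwise x = 3·y with 3 ∤ y, and the prime factorisation of
-- y (nonempty, as x ≠ 3) exhibits x in the required form.

open import Defs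
open import Data.Nat using (ℕ; _<_; _*_; _≤_)
open import Data.Nat.Primality using (Prime)
open import Data.Integer using (+_)
open import Data.List using (List; length)
open import Data.Nat.ListAction using (product)
open import Data.List.Relation.Unary.All using (All)
open import Data.Product using (Σ; _×_)
open import Data.Sum using (_⊎_)
open import Function.Bundles using (_⇔_)
open import Relation.Binary.PropositionalEquality using (_≡_; _≢_)

open import Data.Nat using (zero; suc; z≤n; s≤s; _+_; >-nonZero)
open import Data.Nat.Base using (n>1⇒nonTrivial; nonTrivial⇒n>1)
open import Data.Nat.Divisibility.Core using (hasNonTrivialDivisor)
import Data.Nat.Properties as ℕP
open import Data.Nat.Divisibility
  using (_∣_; divides; _∣?_; _∣0; ∣1⇒≡1; m∣m*n; ∣m⇒∣m*n; ∣n⇒∣m*n; *-pres-∣; *-cancelˡ-∣)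
open import Data.Nat.Primality
  using (prime; prime?; euclidsLemma; ¬prime[1]; prime⇒nonZero; ¬prime⇒composite)
open import Data.Nat.Primality.Factorisation using (factorise; factorisationHasAllPrimeFactors)
open import Data.Integer using (ℤ; -[1+_]; ∣_∣; 1ℤ; -1ℤ; -_; _-_)
import Data.Integer as ℤ
import Data.Integer.Properties as ℤP
import Data.Integer.Divisibility.Signed as ℤS
open import Data.Integer.Tactic.RingSolver using (solve-∀)
open import Data.List using ([]; _∷_; map)
open import Data.List.Membership.Propositional using (_∈_)
open import Data.List.Relation.Unary.Any using (here; there)
import Data.List.Relation.Unary.All as All
open import Data.Product using (∃-syntax; _,_; proj₁; proj₂)
open import Data.Sum using (inj₁; inj₂)
open import Data.Empty using (⊥-elim)
open import Relation.Nullary using (¬_; yes; no)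
open import Relation.Nullary.Decidable using (from-yes)
open import Relation.Binary.PropositionalEquality using (refl; sym; trans; cong; subst)
open import Function.Bundles using (mk⇔)

ProperFactorization : ℕ → ℤ → Set
ProperFactorization n x = Σ (TauFactorization n x) Proper

ThreeTimesPrimes : ℕ → Set
ThreeTimesPrimes x =
  Σ (List ℕ) (λ ps → (1 ≤ length ps) × All (λ p → Prime p × (p ≢ 3)) ps × (x ≡ 3 * product ps))

∣-neg : ∀ {n} z {w} → - z ≡ w → n ∣ ∣ z ∣ → n ∣ ∣ w ∣
∣-neg {n} z refl n∣z = subst (n ∣_) (sym (ℤP.∣-i∣≡∣i∣ z)) n∣z

∣-sum : ∀ {n} z₁ z₂ {z} → z₁ ℤ.+ z₂ ≡ z → n ∣ ∣ z₁ ∣ → n ∣ ∣ z₂ ∣ → n ∣ ∣ z ∣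
∣-sum {n} z₁ z₂ refl n∣z₁ n∣z₂ =
  ℤS.∣⇒∣ᵤ {+ n} {z₁ ℤ.+ z₂} (ℤS.∣m∣n⇒∣m+n (ℤS.∣ᵤ⇒∣ {+ n} {z₁} n∣z₁) (ℤS.∣ᵤ⇒∣ {+ n} {z₂} n∣z₂))

τ-intro : ∀ {n} u v k → u - v ≡ k ℤ.* + n → u τ[ n ] v
τ-intro {n} u v k eq = ℤS.∣⇒∣ᵤ {+ n} {u - v} (ℤS.divides k eq)

τ-refl : ∀ {n} u → u τ[ n ] u
τ-refl u = τ-intro u u (+ 0) (u-u≡0 u)
  where
  u-u≡0 : ∀ (u : ℤ) → u - u ≡ + 0 ℤ.* + 0
  u-u≡0 = solve-∀

τ-sym : ∀ {n} u v → u τ[ n ] v → v τ[ n ] u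
τ-sym u v = ∣-neg (u - v) (negate-difference u v)
  where
  negate-difference : ∀ (u v : ℤ) → - (u - v) ≡ v - u
  negate-difference = solve-∀

τ-trans : ∀ {n} u v w → u τ[ n ] v → v τ[ n ] w → u τ[ n ] w
τ-trans u v w = ∣-sum (u - v) (v - w) (telescope u v w)
  where
  telescope : ∀ (u v w : ℤ) → (u - v) ℤ.+ (v - w) ≡ u - w
  telescope = solve-∀

τ-neg : ∀ {n} u v → u τ[ n ] v → (- u) τ[ n ] (- v)
τ-neg u v = ∣-neg (u - v) (negate-difference u v)
  where
  negate-difference : ∀ (u v : ℤ) → - (u - v) ≡ - u - - v
  negate-difference = solve-∀

τ-multiples : ∀ {n} u v → n ∣ ∣ u ∣ → n ∣ ∣ v ∣ → u τ[ n ] v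
τ-multiples u v n∣u n∣v = ∣-sum u (- v) refl n∣u (∣-neg v refl n∣v)

τ-transfers-∣ : ∀ {n} u v → u τ[ n ] v → n ∣ ∣ v ∣ → n ∣ ∣ u ∣
τ-transfers-∣ u v = ∣-sum (u - v) v (difference-plus u v)
  where
  difference-plus : ∀ (u v : ℤ) → (u - v) ℤ.+ v ≡ u
  difference-plus = solve-∀

prime[3] : Prime 3
prime[3] = from-yes (prime? 3)

data Residue3 : ℕ → Set where
  rem0 : ∀ k → Residue3 (3 * k)
  rem1 : ∀ k → Residue3 (3 * k + 1)
  rem2 : ∀ k → Residue3 (3 * k + 2)

residue3 : ∀ n → Residue3 n
residue3 zero = rem0 0
residue3 (suc n) with residue3 n
... | rem0 k = subst Residue3 (step01 k) (rem1 k)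
  where
  step01 : ∀ k → 3 * k + 1 ≡ suc (3 * k)
  step01 k = ℕP.+-comm (3 * k) 1
... | rem1 k = subst Residue3 (step12 k) (rem2 k)
  where
  step12 : ∀ k → 3 * k + 2 ≡ suc (3 * k + 1)
  step12 k = ℕP.+-suc (3 * k) 1
... | rem2 k = subst Residue3 (step20 k) (rem0 (suc k))
  where
  step20 : ∀ k → 3 * suc k ≡ suc (3 * k + 2)
  step20 k = trans (ℕP.*-suc 3 k) (trans (ℕP.+-comm 3 (3 * k)) (ℕP.+-suc (3 * k) 2))

cast-residue : ∀ k r → + (3 * k + r) ≡ + 3 ℤ.* + k ℤ.+ + r
cast-residue k r = trans (ℤP.pos-+ (3 * k) r) (cong (ℤ._+ + r) (ℤP.pos-* 3 k))

unit-mod-3 : ∀ q → ¬ 3 ∣ q → ((+ q) τ[ 3 ] 1ℤ) ⊎ ((+ q) τ[ 3 ] -1ℤ)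
unit-mod-3 q 3∤q with residue3 q
... | rem0 k = ⊥-elim (3∤q (m∣m*n k))
... | rem1 k = inj₁ (τ-intro (+ (3 * k + 1)) 1ℤ (+ k) (trans (cong (_- 1ℤ) (cast-residue k 1)) (identity (+ k))))
  where
  identity : ∀ (K : ℤ) → (+ 3 ℤ.* K ℤ.+ + 1) - 1ℤ ≡ K ℤ.* + 3
  identity = solve-∀
... | rem2 k = inj₂ (τ-intro (+ (3 * k + 2)) -1ℤ (+ k ℤ.+ 1ℤ) (trans (cong (_- -1ℤ) (cast-residue k 2)) (identity (+ k))))
  where
  identity : ∀ (K : ℤ) → (+ 3 ℤ.* K ℤ.+ + 2) - -1ℤ ≡ (K ℤ.+ 1ℤ) ℤ.* + 3
  identity = solve-∀

congruent-up-to-sign : ∀ {a b} → ¬ 3 ∣ a → ¬ 3 ∣ b → ((+ a) τ[ 3 ] (+ b)) ⊎ ((+ a) τ[ 3 ] (- + b))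
congruent-up-to-sign {a} {b} 3∤a 3∤b with unit-mod-3 a 3∤a | unit-mod-3 b 3∤b
... | inj₁ a≡1  | inj₁ b≡1  = inj₁ (τ-trans (+ a) 1ℤ (+ b) a≡1 (τ-sym (+ b) 1ℤ b≡1))
... | inj₁ a≡1  | inj₂ b≡-1 = inj₂ (τ-trans (+ a) 1ℤ (- + b) a≡1 (τ-sym (- + b) 1ℤ (τ-neg (+ b) -1ℤ b≡-1)))
... | inj₂ a≡-1 | inj₁ b≡1  = inj₂ (τ-trans (+ a) -1ℤ (- + b) a≡-1 (τ-sym (- + b) -1ℤ (τ-neg (+ b) 1ℤ b≡1)))
... | inj₂ a≡-1 | inj₂ b≡-1 = inj₁ (τ-trans (+ a) -1ℤ (+ b) a≡-1 (τ-sym (+ b) -1ℤ b≡-1))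

nonunit⇒2≤∣a∣ : ∀ {a} → NonzeroNonunit a → 2 ≤ ∣ a ∣
nonunit⇒2≤∣a∣ {+ 0} (a≢0 , _) = ⊥-elim (a≢0 refl)
nonunit⇒2≤∣a∣ {+ 1} (_ , a≢1 , _) = ⊥-elim (a≢1 refl)
nonunit⇒2≤∣a∣ {+ suc (suc n)} _ = s≤s (s≤s z≤n)
nonunit⇒2≤∣a∣ { -[1+ 0 ]} (_ , _ , a≢-1) = ⊥-elim (a≢-1 refl)
nonunit⇒2≤∣a∣ { -[1+ suc n ]} _ = s≤s (s≤s z≤n)

positive-nonunit : ∀ {n} → 2 ≤ n → NonzeroNonunit (+ n)
positive-nonunit (s≤s (s≤s _)) = (λ ()) , (λ ()) , (λ ())

negative-nonunit : ∀ {n} → 2 ≤ n → NonzeroNonunit (- (+ n))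
negative-nonunit (s≤s (s≤s _)) = (λ ()) , (λ ()) , (λ ())

product-of-nonunits-positive : ∀ {as} → All NonzeroNonunit as → 1 ≤ product (map ∣_∣ as)
product-of-nonunits-positive All.[] = s≤s z≤n
product-of-nonunits-positive (na All.∷ nas) =
  ℕP.*-mono-≤ (ℕP.≤-trans (s≤s z≤n) (nonunit⇒2≤∣a∣ na)) (product-of-nonunits-positive nas)

abs-prodℤ : ∀ as → ∣ prodℤ as ∣ ≡ product (map ∣_∣ as)
abs-prodℤ [] = refl
abs-prodℤ (a ∷ as) = trans (ℤP.abs-* a (prodℤ as)) (cong (∣ a ∣ *_) (abs-prodℤ as))

abs-sign : ∀ {s} → IsSign s → ∀ z → ∣ s ℤ.* z ∣ ≡ ∣ z ∣
abs-sign (inj₁ refl) z = cong ∣_∣ (ℤP.*-identityˡ z)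
abs-sign (inj₂ refl) z = trans (ℤP.abs-* -1ℤ z) (ℕP.+-identityʳ ∣ z ∣)

factorization-abs : ∀ {n x} (f : TauFactorization n x) → ∣ x ∣ ≡ product (map ∣_∣ (TauFactorization.factors f))
factorization-abs record { factors = as ; isSign = sign ; eq = refl } = trans (abs-sign sign (prodℤ as)) (abs-prodℤ as)

proper-split : ∀ {n x} → ProperFactorization n x →
  ∃[ a ] ∃[ m ] (2 ≤ a × 2 ≤ m × ∣ x ∣ ≡ a * m)
proper-split (f , proper) with TauFactorization.factors f | TauFactorization.nonunit f | factorization-abs f | proper
... | _ ∷ [] | _ | _ | s≤s ()
... | a ∷ b ∷ rest | na All.∷ nb All.∷ nrest | ∣x∣≡ | _ =
  ∣ a ∣ , ∣ b ∣ * product (map ∣_∣ rest) , nonunit⇒2≤∣a∣ na ,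
  ℕP.*-mono-≤ (nonunit⇒2≤∣a∣ nb) (product-of-nonunits-positive nrest) , ∣x∣≡

two-factor-factorization : ∀ {n x} s u v → IsSign s → NonzeroNonunit u → NonzeroNonunit v →
  u τ[ n ] v → x ≡ s ℤ.* (u ℤ.* (v ℤ.* 1ℤ)) → ProperFactorization n x
two-factor-factorization s u v sign nu nv u≡v eq = record
  { sign = s ; factors = u ∷ v ∷ [] ; isSign = sign
  ; nonunit = nu All.∷ nv All.∷ All.[]
  ; congr = (τ-refl u All.∷ u≡v All.∷ All.[]) All.∷ (τ-sym u v u≡v All.∷ τ-refl v All.∷ All.[]) All.∷ All.[]
  ; eq = eq
  } , s≤s (s≤s z≤n)

product-factorization⁺ : ∀ {n a b} → 2 ≤ a → 2 ≤ b → (+ a) τ[ n ] (+ b) → ProperFactorization n (+ (a * b))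
product-factorization⁺ {a = a} {b} 2≤a 2≤b a≡b =
  two-factor-factorization 1ℤ (+ a) (+ b) (inj₁ refl) (positive-nonunit 2≤a) (positive-nonunit 2≤b) a≡b
    (trans (ℤP.pos-* a b) (identity (+ a) (+ b)))
  where
  identity : ∀ (A B : ℤ) → A ℤ.* B ≡ 1ℤ ℤ.* (A ℤ.* (B ℤ.* 1ℤ))
  identity = solve-∀

product-factorization⁻ : ∀ {n a b} → 2 ≤ a → 2 ≤ b → (+ a) τ[ n ] (- + b) → ProperFactorization n (+ (a * b))
product-factorization⁻ {a = a} {b} 2≤a 2≤b a≡-b =
  two-factor-factorization -1ℤ (+ a) (- + b) (inj₂ refl) (positive-nonunit 2≤a) (negative-nonunit 2≤b) a≡-b
    (trans (ℤP.pos-* a b) (identity (+ a) (+ b)))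
  where
  identity : ∀ (A B : ℤ) → A ℤ.* B ≡ -1ℤ ℤ.* (A ℤ.* (- B ℤ.* 1ℤ))
  identity = solve-∀

prime-isAtom : ∀ {n p} → Prime p → ¬ ProperFactorization n (+ p)
prime-isAtom {p = p} (prime notComposite) fact with proper-split fact
... | a , m , 2≤a , 2≤m , p≡a*m =
  notComposite (hasNonTrivialDivisor {{n>1⇒nonTrivial 2≤a}} a<p (subst (a ∣_) (sym p≡a*m) (m∣m*n m)))
  where
  instance _ = >-nonZero (ℕP.≤-trans (s≤s z≤n) 2≤a)
  a<p : a < p
  a<p = subst (a <_) (sym p≡a*m) (ℕP.m<m*n a m 2≤m)

prime-divides-some-factor : ∀ {p} → Prime p → ∀ as → p ∣ product (map ∣_∣ as) → ∃[ c ] (c ∈ as × p ∣ ∣ c ∣)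
prime-divides-some-factor pp [] p∣1 = ⊥-elim (¬prime[1] (subst Prime (∣1⇒≡1 p∣1) pp))
prime-divides-some-factor pp (a ∷ as) p∣a*rest with euclidsLemma ∣ a ∣ (product (map ∣_∣ as)) pp p∣a*rest
... | inj₁ p∣a = a , here refl , p∣a
... | inj₂ p∣rest with prime-divides-some-factor pp as p∣rest
...   | c , c∈as , p∣c = c , there c∈as , p∣c

divides-all : ∀ {n as} → PairwiseTau n as → ∃[ c ] (c ∈ as × n ∣ ∣ c ∣) → All (λ a → n ∣ ∣ a ∣) as
divides-all congr (c , c∈as , n∣c) = All.map (λ {a} row → τ-transfers-∣ a c (All.lookup row c∈as) n∣c) congr

square-divides-product : ∀ {n as} → 1 < length as → All (λ a → n ∣ ∣ a ∣) as → n * n ∣ product (map ∣_∣ as)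
square-divides-product {as = _ ∷ []} (s≤s ()) _
square-divides-product {as = a ∷ b ∷ rest} _ (n∣a All.∷ n∣b All.∷ _) =
  *-pres-∣ n∣a (∣m⇒∣m*n (product (map ∣_∣ rest)) n∣b)

proper-factorization⇒square-divides : ∀ {p x} → Prime p → ProperFactorization p x → p ∣ ∣ x ∣ → p * p ∣ ∣ x ∣
proper-factorization⇒square-divides {p} {x} pp (f , proper) p∣x =
  subst (p * p ∣_) (sym ∣x∣≡) (square-divides-product proper (divides-all congr
    (prime-divides-some-factor pp factors (subst (p ∣_) ∣x∣≡ p∣x))))
  where
  open TauFactorization f
  ∣x∣≡ : ∣ x ∣ ≡ product (map ∣_∣ factors)
  ∣x∣≡ = factorization-abs f

prime-times-coprime-isAtom : ∀ {p y} → Prime p → ¬ p ∣ y → ¬ ProperFactorization p (+ (p * y))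
prime-times-coprime-isAtom {p} {y} pp p∤y fact =
  p∤y (*-cancelˡ-∣ p (proper-factorization⇒square-divides pp fact (m∣m*n y)))
  where instance _ = prime⇒nonZero pp

primes-avoiding-p : ∀ {p ps} → Prime p → All (λ q → Prime q × q ≢ p) ps → ¬ p ∣ product ps
primes-avoiding-p pp hps p∣ps =
  proj₂ (All.lookup hps (factorisationHasAllPrimeFactors pp p∣ps (All.map proj₁ hps))) refl

three-times-primes-isAtom : ∀ {x} → ThreeTimesPrimes x → ¬ ProperFactorization 3 (+ x)
three-times-primes-isAtom (ps , _ , hps , x≡3*ps) =
  subst (λ z → ¬ ProperFactorization 3 (+ z)) (sym x≡3*ps)
    (prime-times-coprime-isAtom prime[3] (primes-avoiding-p prime[3] hps))

composite-split : ∀ {x} → 1 < x → ¬ Prime x → ∃[ q ] ∃[ d ] (2 ≤ q × 2 ≤ d × x ≡ q * d)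
composite-split {x} 1<x ¬px with ¬prime⇒composite {{n>1⇒nonTrivial 1<x}} ¬px
... | hasNonTrivialDivisor {d} {{nt}} d<x (divides q x≡q*d) =
  q , d , cofactor≥2 q x≡q*d , nonTrivial⇒n>1 d , x≡q*d
  where
  cofactor≥2 : ∀ q → x ≡ q * d → 2 ≤ q
  cofactor≥2 zero x≡0 = ⊥-elim (ℕP.m<n⇒n≢0 1<x x≡0)
  cofactor≥2 (suc zero) x≡d = ⊥-elim (ℕP.<⇒≢ d<x (sym (trans x≡d (ℕP.*-identityˡ d))))
  cofactor≥2 (suc (suc q)) _ = s≤s (s≤s z≤n)

primes-not-3 : ∀ ps → All Prime ps → ¬ 3 ∣ product ps → All (λ p → Prime p × p ≢ 3) ps
primes-not-3 [] _ _ = All.[]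
primes-not-3 (p ∷ ps) (pp All.∷ pps) 3∤ps =
  (pp , λ { refl → 3∤ps (m∣m*n (product ps)) }) All.∷ primes-not-3 ps pps (λ 3∣rest → 3∤ps (∣n⇒∣m*n p 3∣rest))

three-times-coprime-form : ∀ {x} y → ¬ Prime x → x ≡ y * 3 → ¬ 3 ∣ y → ThreeTimesPrimes x
three-times-coprime-form zero _ _ 3∤0 = ⊥-elim (3∤0 (3 ∣0))
three-times-coprime-form {x} y@(suc _) ¬px x≡y*3 3∤y with factorise y
... | record { factors = ps ; isFactorisation = y≡ps ; factorsPrime = pps } =
  ps , nonempty ps y≡ps , primes-not-3 ps pps (subst (λ z → ¬ 3 ∣ z) y≡ps 3∤y) , x≡3*ps
  where
  x≡3*ps : x ≡ 3 * product ps
  x≡3*ps = trans x≡y*3 (trans (ℕP.*-comm y 3) (cong (3 *_) y≡ps))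
  nonempty : ∀ qs → y ≡ product qs → 1 ≤ length qs
  nonempty [] y≡1 = ⊥-elim (¬px (subst Prime (sym (trans x≡y*3 (cong (_* 3) y≡1))) prime[3]))
  nonempty (_ ∷ _) _ = s≤s z≤n

coprime-to-3-factorization : ∀ {x} → 1 < x → ¬ Prime x → ¬ 3 ∣ x → ProperFactorization 3 (+ x)
coprime-to-3-factorization 1<x ¬px 3∤x with composite-split 1<x ¬px
... | q , d , 2≤q , 2≤d , x≡q*d = subst (λ z → ProperFactorization 3 (+ z)) (sym x≡q*d) factorization
  where
  3∤q : ¬ 3 ∣ q
  3∤q 3∣q = 3∤x (subst (3 ∣_) (sym x≡q*d) (∣m⇒∣m*n d 3∣q))
  3∤d : ¬ 3 ∣ d
  3∤d 3∣d = 3∤x (subst (3 ∣_) (sym x≡q*d) (∣n⇒∣m*n q 3∣d))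
  factorization : ProperFactorization 3 (+ (q * d))
  factorization with congruent-up-to-sign 3∤q 3∤d
  ... | inj₁ q≡d = product-factorization⁺ 2≤q 2≤d q≡d
  ... | inj₂ q≡-d = product-factorization⁻ 2≤q 2≤d q≡-d

multiple-of-9-factorization : ∀ {x} y → 1 < x → x ≡ y * 3 → 3 ∣ y → ProperFactorization 3 (+ x)
multiple-of-9-factorization zero 1<x x≡0 _ = ⊥-elim (ℕP.m<n⇒n≢0 1<x x≡0)
multiple-of-9-factorization (suc zero) _ _ 3∣1 with ∣1⇒≡1 3∣1
... | ()
multiple-of-9-factorization y@(suc (suc _)) _ x≡y*3 3∣y =
  subst (λ z → ProperFactorization 3 (+ z)) (sym x≡y*3)
    (product-factorization⁺ {3} {y} {3} (s≤s (s≤s z≤n)) (s≤s (s≤s z≤n)) (τ-multiples (+ y) (+ 3) 3∣y (divides 1 refl)))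

composite-atom-form : ∀ {x} → 1 < x → ¬ Prime x → ¬ ProperFactorization 3 (+ x) → ThreeTimesPrimes x
composite-atom-form {x} 1<x ¬px atom with 3 ∣? x
... | no 3∤x = ⊥-elim (atom (coprime-to-3-factorization 1<x ¬px 3∤x))
... | yes (divides y x≡y*3) with 3 ∣? y
...   | yes 3∣y = ⊥-elim (atom (multiple-of-9-factorization y 1<x x≡y*3 3∣y))
...   | no 3∤y = three-times-coprime-form y ¬px x≡y*3 3∤y

theorem3 : (x : ℕ) → 1 < x →
    IsTauAtom 3 (+ x) ⇔
      (Prime x ⊎
        Σ (List ℕ) (λ ps → (1 ≤ length ps) × All (λ p → Prime p × (p ≢ 3)) ps × (x ≡ 3 * product ps)))
theorem3 x 1<x = mk⇔ atom⇒ ⇒atom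
  where
  atom⇒ : IsTauAtom 3 (+ x) → Prime x ⊎ ThreeTimesPrimes x
  atom⇒ (_ , noFactorization) with prime? x
  ... | yes px = inj₁ px
  ... | no ¬px = inj₂ (composite-atom-form 1<x ¬px noFactorization)
  ⇒atom : Prime x ⊎ ThreeTimesPrimes x → IsTauAtom 3 (+ x)
  ⇒atom (inj₁ px) = positive-nonunit 1<x , prime-isAtom px
  ⇒atom (inj₂ form) = positive-nonunit 1<x , three-times-primes-isAtom form
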